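{- Let $k\in\{9,10\}$ and let $G,\mathcal{F},G',\mathcal{W}$, $\mathcal{I}_4$ be as in the context. Let $K$ be a connected component of $\mathcal{F}+\mathcal{W}$ such that $(K)_m$ is a single node and $K\notin\mathcal{I}_4$. Then $K$ has a $k$-pp with at least $\frac45|F_K|$ edges, where $F_K=E(K)\cap E(\mathcal{F})$.
   Context: $G=(V,E)$ is a simple undirected graph. A $k$-pp of a graph is a spanning subgraph whose components are paths with at most $k$ vertices. A path-cycle cover is a spanning subgraph whose components are paths or cycles; $\mathcal{F}$ is a triangle-free one (no 3-cycle components) of $G$ with maximum number of edges. A short cycle is a cycle component of $\mathcal{F}$ with 4 or 5 vertices. $G'$ is the spanning subgraph of $G$ with edges $\{u,v\}\in E$ such that $u,v$ lie in different components of $\mathcal{F}$ and at least one lies in a short cycle. A 4-vertex cycle of $\mathcal{F}$ is saturated by $E'\subseteq E(G')$ if some edge of $E'$ is incident to one of its vertices; the weight of $E'$ is the number of 4-vertex cycles of $\mathcal{F}$ saturated by $E'$. $\mathcal{W}$ is a path-cycle cover of $G'$ maximizing the weight of $E(\mathcal{W})$ and stingy (removing any edge of $\mathcal{W}$ strictly decreases the weight). $\mathcal{F}+\mathcal{W}=(V,E(\mathcal{F})\cup E(\mathcal{W}))$. $\mathcal{I}_4$ is the set of 4-vertex cycles of $\mathcal{F}$ not saturated by $E(\mathcal{W})$ (each is itself a component of $\mathcal{F}+\mathcal{W}$). For a component $K$ of $\mathcal{F}+\mathcal{W}$, $(K)_m$ is obtained by contracting each component of $\mathcal{F}$ in $K$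 to a node, nodes being adjacent iff $\mathcal{W}$ has an edge between the corresponding components. -}

module Defs where

open import Data.Nat using (ℕ; _≤_; _<_; _<ᵇ_)
open import Data.Fin using (Fin; toℕ; _≟_)
open import Data.Bool using (Bool; true; false; _∧_; _∨_; not; if_then_else_)
open import Data.List using (List; []; _∷_; _++_; length; map; allFin)
open import Data.Nat.ListAction using (sum)
open import Data.List.Membership.Propositional using (_∈_)
open import Data.List.Relation.Unary.Unique.Propositional using (Unique)
open import Data.Product using (Σ; ∃; ∃₂; _×_; _,_)
open import Data.Sum using (_⊎_)
open import Data.Empty using (⊥)
open import Relation.Nullary using (¬_; ⌊_⌋)
open import Relation.Binary.PropositionalEquality using (_≡_)
open import Function using (_⇔_)

Graph : ℕ → Set
Graph n = Fin n → Fin n → Bool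

VSet : ℕ → Set
VSet n = Fin n → Bool

IsSimple : ∀ {n} → Graph n → Set
IsSimple H = (∀ u v → H u v ≡ H v u) × (∀ v → H v v ≡ false)

ecount : ∀ {n} → Graph n → ℕ
ecount {n} H = sum (map (λ i → sum (map (λ j →
  if (toℕ i <ᵇ toℕ j) ∧ H i j then 1 else 0) (allFin n))) (allFin n))

data Reach {n} (H : Graph n) : Fin n → Fin n → Set where
  here : ∀ {v} → Reach H v v
  step : ∀ {u w v} → H u w ≡ true → Reach H w v → Reach H u v

IsComponent : ∀ {n} → Graph n → VSet n → Set
IsComponent H S =
  (∃ λ v → S v ≡ true) × (∀ u v → S u ≡ true → (S v ≡ true ⇔ Reach H u v))

Consec : ∀ {n} → List (Fin n) → Fin n → Fin n → Set
Consec (x ∷ y ∷ r) u v = (u ≡ x × v ≡ y) ⊎ (u ≡ y × v ≡ x) ⊎ Consec (y ∷ r) u v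
Consec _ u v = ⊥

CycConsec : ∀ {n} → List (Fin n) → Fin n → Fin n → Set
CycConsec [] u v = ⊥
CycConsec (x ∷ r) u v = Consec ((x ∷ r) ++ (x ∷ [])) u v

PathComp : ∀ {n} → Graph n → VSet n → ℕ → Set
PathComp {n} H S m = Σ (List (Fin n)) λ vs →
  length vs ≡ m × 1 ≤ m × Unique vs × (∀ v → (v ∈ vs ⇔ S v ≡ true)) ×
  (∀ u v → S u ≡ true → (H u v ≡ true ⇔ Consec vs u v))

CycleComp : ∀ {n} → Graph n → VSet n → ℕ → Set
CycleComp {n} H S m = Σ (List (Fin n)) λ vs →
  length vs ≡ m × 3 ≤ m × Unique vs × (∀ v → (v ∈ vs ⇔ S v ≡ true)) ×
  (∀ u v → S u ≡ true → (H u v ≡ true ⇔ CycConsec vs u v))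

Edge : ∀ {n} → Graph n → Fin n → Fin n → Set
Edge G u v = G u v ≡ true

IsPCC : ∀ {n} → (Fin n → Fin n → Set) → Graph n → Set
IsPCC R H = IsSimple H × (∀ u v → H u v ≡ true → R u v) ×
  (∀ S → IsComponent H S → (∃ λ m → PathComp H S m) ⊎ (∃ λ m → CycleComp H S m))

TriangleFree : ∀ {n} → Graph n → Set
TriangleFree H = ∀ S → IsComponent H S → ¬ CycleComp H S 3

IsMaxTFPCC : ∀ {n} → Graph n → Graph n → Set
IsMaxTFPCC G F = (IsPCC (Edge G) F × TriangleFree F) ×
  (∀ H → IsPCC (Edge G) H → TriangleFree H → ecount H ≤ ecount F)

InShortCycle : ∀ {n} → Graph n → Fin n → Set
InShortCycle F v = ∃ λ S → IsComponent F S × S v ≡ true × (CycleComp F S 4 ⊎ CycleComp F S 5)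

G'Edge : ∀ {n} → Graph n → Graph n → Fin n → Fin n → Set
G'Edge G F u v = G u v ≡ true × ¬ Reach F u v × (InShortCycle F u ⊎ InShortCycle F v)

Is4Cycle : ∀ {n} → Graph n → VSet n → Set
Is4Cycle F S = IsComponent F S × CycleComp F S 4

Saturates : ∀ {n} → Graph n → VSet n → Set
Saturates E' S = ∃₂ λ x y → S x ≡ true × E' x y ≡ true

-- v is the least vertex of a 4-cycle of F saturated by E'
-- (used to count saturated 4-cycles, one representative each).
SatRep : ∀ {n} → Graph n → Graph n → Fin n → Set
SatRep F E' v = ∃ λ S → Is4Cycle F S × S v ≡ true ×
  (∀ u → S u ≡ true → toℕ v ≤ toℕ u) × Saturates E' S

Card : ∀ {n} → (Fin n → Set) → ℕ → Set
Card {n} P c = Σ (List (Fin n)) λ xs →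
  Unique xs × (∀ v → (v ∈ xs ⇔ P v)) × length xs ≡ c

WeightIs : ∀ {n} → Graph n → Graph n → ℕ → Set
WeightIs F E' w = Card (SatRep F E') w

removeEdge : ∀ {n} → Graph n → Fin n → Fin n → Graph n
removeEdge H u v a b =
  H a b ∧ not ((⌊ a ≟ u ⌋ ∧ ⌊ b ≟ v ⌋) ∨ (⌊ a ≟ v ⌋ ∧ ⌊ b ≟ u ⌋))

-- W is a maximum-weight, stingy path-cycle cover of G'.
IsW : ∀ {n} → Graph n → Graph n → Graph n → Set
IsW G F W = IsPCC (G'Edge G F) W ×
  (∀ W' → IsPCC (G'Edge G F) W' → ∀ w w' → WeightIs F W w → WeightIs F W' w' → w' ≤ w) ×
  (∀ u v → W u v ≡ true → ∀ w w' → WeightIs F W w → WeightIs F (removeEdge W u v) w' → w' < w)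

_⊕_ : ∀ {n} → Graph n → Graph n → Graph n
(F ⊕ W) a b = F a b ∨ W a b

InI4 : ∀ {n} → Graph n → Graph n → VSet n → Set
InI4 F W S = Is4Cycle F S × ¬ Saturates W S

-- (K)_m is a single node: all vertices of K lie in one component of F.
SingleNode : ∀ {n} → Graph n → VSet n → Set
SingleNode F S = ∀ u v → S u ≡ true → S v ≡ true → Reach F u v

FK : ∀ {n} → Graph n → VSet n → ℕ
FK F S = ecount (λ a b → F a b ∧ S a ∧ S b)

-- P is a k-pp of the component K (vertex set S) of H: a subgraph of K
-- (extended by isolated vertices outside S) whose components are paths with ≤ k vertices.
IsKPP : ∀ {n} → ℕ → Graph n → VSet n → Graph n → Set
IsKPP k H S P = IsSimple P ×
  (∀ a b → P a b ≡ true → S a ≡ true × S b ≡ true × H a b ≡ true) ×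
  (∀ C → IsComponent P C → ∃ λ m → m ≤ k × PathComp P C m)

-- By the single-node hypothesis K lies inside one component of F and, since W only joins distinct
-- components of F, K contains no edge of W: K is a component of F.  So it is a path, or a cycle on
-- at least 5 vertices (F has no triangles, and a 4-cycle without incident W-edges would be in I_4).
-- Cut its vertex sequence into blocks of 9 consecutive vertices and keep the edges inside blocks.
-- On a path with L vertices this keeps at least 8/9 of the L - 1 edges.  On a cycle with L ≥ 10
-- vertices it keeps at least 8/9 of L - 1 ≥ 9L/10, and on a cycle with 5 ≤ L ≤ 9 vertices it keeps
-- L - 1 ≥ 4L/5 of the L edges.
module Submission where

open import Defs
open import Data.Nat using (ℕ; zero; suc; _+_; _∸_; _*_; _≤_; _<_; _<ᵇ_; z≤n; s≤s; _≤?_)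
open import Data.Nat.Properties hiding (_≟_; suc-injective)
open import Data.Nat.ListAction using (sum)
open import Algebra.Properties.CommutativeSemigroup +-commutativeSemigroup using (interchange)
open import Data.Fin using (Fin; toℕ; _≟_)
import Data.Fin as Fin
open import Data.Fin.Properties using (toℕ-injective; suc-injective)
open import Data.Bool using (Bool; true; false; _∧_; _∨_; if_then_else_)
open import Data.Bool.Properties using (T-≡; ¬-not; ∨-comm; ∧-comm; ∧-zeroʳ)
open import Data.List using (List; []; _∷_; _++_; length; map; allFin; take; drop; tabulate)
open import Data.List.Properties
  using (map-cong; map-tabulate; length-take; length-drop; length-++; take-all; drop-all; take++drop≡id)
open import Data.List.Membership.Propositional using (_∈_; _∉_)
open import Data.List.Membership.Propositional.Properties using (∈-++⁺ʳ)
open import Data.List.Relation.Unary.Any using (here; there; any?)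
open import Data.List.Relation.Unary.All as All using ()
open import Data.List.Relation.Unary.AllPairs using ([]; _∷_)
open import Data.List.Relation.Unary.Unique.Propositional using (Unique)
open import Data.List.Relation.Unary.Unique.Propositional.Properties using (take⁺; drop⁺)
open import Data.Product using (∃; _×_; _,_; proj₁; proj₂)
open import Data.Sum using (_⊎_; inj₁; inj₂; [_,_])
open import Data.Empty using (⊥-elim)
open import Relation.Nullary using (¬_; yes; no)
open import Relation.Nullary.Decidable using (⌊_⌋; toWitness; fromWitness)
open import Relation.Binary.Definitions using (tri<; tri≈; tri>)
open import Relation.Binary.PropositionalEquality using (_≡_; _≢_; refl; sym; trans; cong; cong₂; subst)
open import Function using (_∘_; _⇔_; Equivalence; mk⇔)

open Equivalence using (to; from)

∨-true : ∀ p q → p ∨ q ≡ true → p ≡ true ⊎ q ≡ true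
∨-true true  q _ = inj₁ refl
∨-true false q e = inj₂ e

∨-trueˡ : ∀ {p} q → p ≡ true → p ∨ q ≡ true
∨-trueˡ q refl = refl

∨-trueʳ : ∀ p {q} → q ≡ true → p ∨ q ≡ true
∨-trueʳ true  _ = refl
∨-trueʳ false e = e

∧-true : ∀ p q → p ∧ q ≡ true → p ≡ true × q ≡ true
∧-true true q e = refl , e

<ᵇ-true : ∀ {m k} → m < k → (m <ᵇ k) ≡ true
<ᵇ-true m<k = to T-≡ (<⇒<ᵇ m<k)

<ᵇ-false : ∀ {m k} → ¬ m < k → (m <ᵇ k) ≡ false
<ᵇ-false {m} {k} m≮k = ¬-not (m≮k ∘ <ᵇ⇒< m k ∘ from T-≡)

oneIf : Bool → ℕ
oneIf b = if b then 1 else 0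

oneIf-∧-mono : ∀ t {p q} → (p ≡ true → q ≡ true) → oneIf (t ∧ p) ≤ oneIf (t ∧ q)
oneIf-∧-mono false         _ = z≤n
oneIf-∧-mono true  {false} _ = z≤n
oneIf-∧-mono true  {true}  p⇒q rewrite p⇒q refl = ≤-refl

oneIf-∧-∨ : ∀ t p q → (p ≡ true → q ≡ false) → oneIf (t ∧ (p ∨ q)) ≡ oneIf (t ∧ p) + oneIf (t ∧ q)
oneIf-∧-∨ false p     q _ = refl
oneIf-∧-∨ true  false q _ = refl
oneIf-∧-∨ true  true  q p⇒¬q rewrite p⇒¬q refl = refl

oneIf-∧-∨-≤ : ∀ t p q → oneIf (t ∧ (p ∨ q)) ≤ oneIf (t ∧ p) + oneIf (t ∧ q)
oneIf-∧-∨-≤ false p     q = z≤n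
oneIf-∧-∨-≤ true  false q = ≤-refl
oneIf-∧-∨-≤ true  true  q = s≤s z≤n

pred*-+-≤ : ∀ s t e → (s ∸ 1) * t ≤ s * e → (s ∸ 1) * (s + t) ≤ s * (s ∸ 1 + e)
pred*-+-≤ s t e h = begin
  (s ∸ 1) * (s + t)         ≡⟨ *-distribˡ-+ (s ∸ 1) s t ⟩
  (s ∸ 1) * s + (s ∸ 1) * t ≤⟨ +-mono-≤ (≤-reflexive (*-comm (s ∸ 1) s)) h ⟩
  s * (s ∸ 1) + s * e       ≡⟨ *-distribˡ-+ s (s ∸ 1) e ⟨
  s * (s ∸ 1 + e)           ∎
  where open ≤-Reasoning

*-≤-suc*-pred : ∀ m {L} → suc m ≤ L → m * L ≤ suc m * (L ∸ 1)
*-≤-suc*-pred m sm≤L with m≤n⇒∃[o]m+o≡n sm≤L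
... | t , refl = begin
  m * (suc m + t)       ≡⟨ *-distribˡ-+ m (suc m) t ⟩
  m * suc m + m * t     ≤⟨ +-mono-≤ (≤-reflexive (*-comm m (suc m))) (*-monoˡ-≤ t (n≤1+n m)) ⟩
  suc m * m + suc m * t ≡⟨ *-distribˡ-+ (suc m) m t ⟨
  suc m * (m + t)       ∎
  where open ≤-Reasoning

eight-ninths⇒four-fifths : ∀ x y e → 9 * x ≤ 10 * y → 8 * y ≤ 9 * e → 4 * x ≤ 5 * e
eight-ninths⇒four-fifths x y e 9x≤10y 8y≤9e = *-cancelˡ-≤ 9 (begin
  9 * (4 * x) ≡⟨ trans (sym (*-assoc 9 4 x)) (*-assoc 4 9 x) ⟩
  4 * (9 * x) ≤⟨ *-monoʳ-≤ 4 9x≤10y ⟩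
  4 * (10 * y) ≡⟨ trans (sym (*-assoc 4 10 y)) (*-assoc 5 8 y) ⟩
  5 * (8 * y) ≤⟨ *-monoʳ-≤ 5 8y≤9e ⟩
  5 * (9 * e) ≡⟨ trans (sym (*-assoc 5 9 e)) (*-assoc 9 5 e) ⟩
  9 * (5 * e) ∎)
  where open ≤-Reasoning

module _ {A : Set} where

  sum-map-cong : ∀ (xs : List A) {f g : A → ℕ} → (∀ x → f x ≡ g x) → sum (map f xs) ≡ sum (map g xs)
  sum-map-cong xs f≗g = cong sum (map-cong f≗g xs)

  sum-map-mono : ∀ (xs : List A) {f g : A → ℕ} → (∀ x → f x ≤ g x) → sum (map f xs) ≤ sum (map g xs)
  sum-map-mono []       _   = z≤n
  sum-map-mono (x ∷ xs) f≤g = +-mono-≤ (f≤g x) (sum-map-mono xs f≤g)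

  sum-map-+ : ∀ (xs : List A) (f g : A → ℕ) →
              sum (map (λ x → f x + g x) xs) ≡ sum (map f xs) + sum (map g xs)
  sum-map-+ []       f g = refl
  sum-map-+ (x ∷ xs) f g = trans (cong (f x + g x +_) (sum-map-+ xs f g)) (interchange (f x) (g x) _ _)

  sum-map-zero : ∀ (xs : List A) (f : A → ℕ) → (∀ x → f x ≡ 0) → sum (map f xs) ≡ 0
  sum-map-zero []       f _  = refl
  sum-map-zero (x ∷ xs) f f0 rewrite f0 x = sum-map-zero xs f f0

map-allFin-suc : ∀ {m} {A : Set} (g : Fin (suc m) → A) →
                 map g (tabulate Fin.suc) ≡ map (g ∘ Fin.suc) (allFin m)
map-allFin-suc g = trans (map-tabulate Fin.suc g) (sym (map-tabulate (λ i → i) (g ∘ Fin.suc)))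

sum-allFin-point : ∀ {m} (q : Fin m) (g : Fin m → ℕ) → (∀ j → j ≢ q → g j ≡ 0) →
                   sum (map g (allFin m)) ≡ g q
sum-allFin-point {suc m} Fin.zero g off =
  trans (cong (g Fin.zero +_) (trans (cong sum (map-allFin-suc g))
                                     (sum-map-zero (allFin m) (g ∘ Fin.suc) (λ j → off (Fin.suc j) λ ()))))
        (+-identityʳ (g Fin.zero))
sum-allFin-point {suc m} (Fin.suc q) g off =
  cong₂ _+_ (off Fin.zero λ ())
            (trans (cong sum (map-allFin-suc g))
                   (sum-allFin-point q (g ∘ Fin.suc) (λ j j≢q → off (Fin.suc j) (j≢q ∘ suc-injective))))

module _ {n : ℕ} where

  Σ² : (Fin n → Fin n → ℕ) → ℕ
  Σ² g = sum (map (λ i → sum (map (g i) (allFin n))) (allFin n))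

  Σ²-cong : ∀ {g h} → (∀ i j → g i j ≡ h i j) → Σ² g ≡ Σ² h
  Σ²-cong g≗h = sum-map-cong (allFin n) (λ i → sum-map-cong (allFin n) (g≗h i))

  Σ²-mono : ∀ {g h} → (∀ i j → g i j ≤ h i j) → Σ² g ≤ Σ² h
  Σ²-mono g≤h = sum-map-mono (allFin n) (λ i → sum-map-mono (allFin n) (g≤h i))

  Σ²-+ : ∀ g h → Σ² (λ i j → g i j + h i j) ≡ Σ² g + Σ² h
  Σ²-+ g h = trans (sum-map-cong (allFin n) (λ i → sum-map-+ (allFin n) (g i) (h i)))
                   (sum-map-+ (allFin n) _ _)

  Σ²-zero : ∀ g → (∀ i j → g i j ≡ 0) → Σ² g ≡ 0
  Σ²-zero g g0 = sum-map-zero (allFin n) _ (λ i → sum-map-zero (allFin n) (g i) (g0 i))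

  Σ²-point : ∀ p q g → (∀ i j → ¬ (i ≡ p × j ≡ q) → g i j ≡ 0) → Σ² g ≡ g p q
  Σ²-point p q g off =
    trans (sum-allFin-point p _ (λ i i≢p → sum-map-zero (allFin n) (g i) (λ j → off i j (i≢p ∘ proj₁))))
          (sum-allFin-point q (g p) (λ j j≢q → off p j (j≢q ∘ proj₂)))

  -- ecount H is, definitionally, Σ² (countsEdge H).
  countsEdge : Graph n → Fin n → Fin n → ℕ
  countsEdge H i j = oneIf ((toℕ i <ᵇ toℕ j) ∧ H i j)

  countsEdge-zero : ∀ H i j → (H i j ≡ true → ¬ toℕ i < toℕ j) → countsEdge H i j ≡ 0
  countsEdge-zero H i j h with H i j
  ... | false = cong oneIf (∧-zeroʳ (toℕ i <ᵇ toℕ j))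
  ... | true rewrite <ᵇ-false (h refl) = refl

  ecount-cong : ∀ {H H'} → (∀ a b → H a b ≡ H' a b) → ecount H ≡ ecount H'
  ecount-cong H≗H' = Σ²-cong (λ i j → cong (λ t → oneIf ((toℕ i <ᵇ toℕ j) ∧ t)) (H≗H' i j))

  ecount-mono : ∀ {H H'} → (∀ a b → H a b ≡ true → H' a b ≡ true) → ecount H ≤ ecount H'
  ecount-mono {H} {H'} H⊆H' = Σ²-mono (λ i j → oneIf-∧-mono (toℕ i <ᵇ toℕ j) (H⊆H' i j))

  ecount-⊕ : ∀ H H' → (∀ a b → H a b ≡ true → H' a b ≡ false) → ecount (H ⊕ H') ≡ ecount H + ecount H'
  ecount-⊕ H H' disjoint =
    trans (Σ²-cong (λ i j → oneIf-∧-∨ (toℕ i <ᵇ toℕ j) (H i j) (H' i j) (disjoint i j)))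
          (Σ²-+ (countsEdge H) (countsEdge H'))

  ecount-⊕-≤ : ∀ H H' → ecount (H ⊕ H') ≤ ecount H + ecount H'
  ecount-⊕-≤ H H' =
    ≤-trans (Σ²-mono (λ i j → oneIf-∧-∨-≤ (toℕ i <ᵇ toℕ j) (H i j) (H' i j)))
            (≤-reflexive (Σ²-+ (countsEdge H) (countsEdge H')))

  ecount-loops : ∀ H → (∀ a b → H a b ≡ true → a ≡ b) → ecount H ≡ 0
  ecount-loops H loops = Σ²-zero _ (λ i j → countsEdge-zero H i j (λ e → <-irrefl (cong toℕ (loops i j e))))

  emptyGraph : Graph n
  emptyGraph _ _ = false

  edge : Fin n → Fin n → Graph n
  edge x y a b = (⌊ a ≟ x ⌋ ∧ ⌊ b ≟ y ⌋) ∨ (⌊ a ≟ y ⌋ ∧ ⌊ b ≟ x ⌋)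

  ≟-true : ∀ {u v : Fin n} → ⌊ u ≟ v ⌋ ≡ true → u ≡ v
  ≟-true e = toWitness (from T-≡ e)

  ≟-refl : ∀ (u : Fin n) → ⌊ u ≟ u ⌋ ≡ true
  ≟-refl u = to T-≡ (fromWitness refl)

  edge-sound : ∀ x y a b → edge x y a b ≡ true → (a ≡ x × b ≡ y) ⊎ (a ≡ y × b ≡ x)
  edge-sound x y a b e with ∨-true (⌊ a ≟ x ⌋ ∧ ⌊ b ≟ y ⌋) _ e
  ... | inj₁ e₁ = let (a≡x , b≡y) = ∧-true _ _ e₁ in inj₁ (≟-true a≡x , ≟-true b≡y)
  ... | inj₂ e₂ = let (a≡y , b≡x) = ∧-true _ _ e₂ in inj₂ (≟-true a≡y , ≟-true b≡x)

  edge-complete : ∀ {x y a b} → (a ≡ x × b ≡ y) ⊎ (a ≡ y × b ≡ x) → edge x y a b ≡ true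
  edge-complete {x} {y} (inj₁ (refl , refl)) rewrite ≟-refl x | ≟-refl y = refl
  edge-complete {x} {y} (inj₂ (refl , refl)) rewrite ≟-refl x | ≟-refl y = ∨-trueʳ (⌊ y ≟ x ⌋ ∧ ⌊ x ≟ y ⌋) refl

  edge-sym : ∀ x y a b → edge x y a b ≡ edge x y b a
  edge-sym x y a b =
    trans (∨-comm (⌊ a ≟ x ⌋ ∧ ⌊ b ≟ y ⌋) _) (cong₂ _∨_ (∧-comm ⌊ a ≟ y ⌋ ⌊ b ≟ x ⌋) (∧-comm ⌊ a ≟ x ⌋ ⌊ b ≟ y ⌋))

  edge-swap : ∀ x y a b → edge x y a b ≡ edge y x a b
  edge-swap x y a b = ∨-comm (⌊ a ≟ x ⌋ ∧ ⌊ b ≟ y ⌋) _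

  ecount-edge< : ∀ {p q} → toℕ p < toℕ q → ecount (edge p q) ≡ 1
  ecount-edge< {p} {q} p<q = trans (Σ²-point p q _ off) counted
    where
    counted : countsEdge (edge p q) p q ≡ 1
    counted = cong₂ (λ s t → oneIf (s ∧ t)) (<ᵇ-true p<q) (edge-complete {p} {q} (inj₁ (refl , refl)))
    off : ∀ i j → ¬ (i ≡ p × j ≡ q) → countsEdge (edge p q) i j ≡ 0
    off i j ≢pq = countsEdge-zero (edge p q) i j λ e →
      [ ⊥-elim ∘ ≢pq , (λ { (refl , refl) → <⇒≯ p<q }) ] (edge-sound p q i j e)

  ecount-edge : ∀ {x y} → x ≢ y → ecount (edge x y) ≡ 1
  ecount-edge {x} {y} x≢y with <-cmp (toℕ x) (toℕ y)
  ... | tri< x<y _ _ = ecount-edge< x<y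
  ... | tri≈ _ x≡y _ = ⊥-elim (x≢y (toℕ-injective x≡y))
  ... | tri> _ _ y<x = trans (ecount-cong (edge-swap x y)) (ecount-edge< y<x)

  ecount-edge-≤1 : ∀ x y → ecount (edge x y) ≤ 1
  ecount-edge-≤1 x y with x ≟ y
  ... | no x≢y = ≤-reflexive (ecount-edge x≢y)
  ... | yes refl = ≤-trans (≤-reflexive (ecount-loops (edge x x) loop)) z≤n
    where loop : ∀ a b → edge x x a b ≡ true → a ≡ b
          loop a b e = [ (λ { (refl , refl) → refl }) , (λ { (refl , refl) → refl }) ] (edge-sound x x a b e)

  Reach-trans : ∀ {H : Graph n} {a b c} → Reach H a b → Reach H b c → Reach H a c
  Reach-trans here         r' = r'
  Reach-trans (step e r) r' = step e (Reach-trans r r')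

  Reach-mono : ∀ {H H' : Graph n} → (∀ a b → H a b ≡ true → H' a b ≡ true) →
               ∀ {a b} → Reach H a b → Reach H' a b
  Reach-mono H⊆H' here                 = here
  Reach-mono H⊆H' (step {u} {w} e r) = step (H⊆H' u w e) (Reach-mono H⊆H' r)

  Reach-emptyGraph : ∀ {a b} → Reach emptyGraph a b → a ≡ b
  Reach-emptyGraph here = refl

  Consec-∈ : ∀ l {a b : Fin n} → Consec l a b → a ∈ l × b ∈ l
  Consec-∈ (x ∷ y ∷ r) (inj₁ (refl , refl))        = here refl , there (here refl)
  Consec-∈ (x ∷ y ∷ r) (inj₂ (inj₁ (refl , refl))) = there (here refl) , here refl
  Consec-∈ (x ∷ y ∷ r) (inj₂ (inj₂ c))              = let (a∈ , b∈) = Consec-∈ (y ∷ r) c in there a∈ , there b∈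

  Consec-++ˡ : ∀ xs ys {a b : Fin n} → Consec xs a b → Consec (xs ++ ys) a b
  Consec-++ˡ (x ∷ y ∷ r) ys (inj₁ p)        = inj₁ p
  Consec-++ˡ (x ∷ y ∷ r) ys (inj₂ (inj₁ p)) = inj₂ (inj₁ p)
  Consec-++ˡ (x ∷ y ∷ r) ys (inj₂ (inj₂ c)) = inj₂ (inj₂ (Consec-++ˡ (y ∷ r) ys c))

  Consec-++ʳ : ∀ xs ys {a b : Fin n} → Consec ys a b → Consec (xs ++ ys) a b
  Consec-++ʳ []           ys c = c
  Consec-++ʳ (x ∷ [])     (y ∷ r) c = inj₂ (inj₂ c)
  Consec-++ʳ (x ∷ x' ∷ xs) ys c = inj₂ (inj₂ (Consec-++ʳ (x' ∷ xs) ys c))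

  Consec-irrefl : ∀ l {a : Fin n} → Unique l → ¬ Consec l a a
  Consec-irrefl (x ∷ y ∷ r) (x∉ ∷ _) (inj₁ (refl , a≡y))        = All.head x∉ a≡y
  Consec-irrefl (x ∷ y ∷ r) (x∉ ∷ _) (inj₂ (inj₁ (refl , a≡x))) = All.head x∉ (sym a≡x)
  Consec-irrefl (x ∷ y ∷ r) (_ ∷ uq) (inj₂ (inj₂ c))              = Consec-irrefl (y ∷ r) uq c

  Reach-along : ∀ (P : Graph n) l → (∀ a b → Consec l a b → P a b ≡ true) →
                ∀ {a b} → a ∈ l → b ∈ l → Reach P a b
  Reach-along P (x ∷ [])    _ (here refl) (here refl) = here
  Reach-along P (x ∷ y ∷ r) _ (here refl) (here refl) = here
  Reach-along P (x ∷ y ∷ r) P⊇ (here refl) (there b∈) =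
    step (P⊇ x y (inj₁ (refl , refl))) (Reach-along P (y ∷ r) (λ a b → P⊇ a b ∘ inj₂ ∘ inj₂) (here refl) b∈)
  Reach-along P (x ∷ y ∷ r) P⊇ (there a∈) (here refl) =
    Reach-trans (Reach-along P (y ∷ r) (λ a b → P⊇ a b ∘ inj₂ ∘ inj₂) a∈ (here refl))
                (step (P⊇ y x (inj₂ (inj₁ (refl , refl)))) here)
  Reach-along P (x ∷ y ∷ r) P⊇ (there a∈) (there b∈) =
    Reach-along P (y ∷ r) (λ a b → P⊇ a b ∘ inj₂ ∘ inj₂) a∈ b∈

  Unique-++-disjoint : ∀ xs ys {a : Fin n} → Unique (xs ++ ys) → a ∈ xs → a ∉ ys
  Unique-++-disjoint (x ∷ xs) ys (x∉ ∷ _)  (here refl) a∈ys = All.lookup x∉ (∈-++⁺ʳ xs a∈ys) refl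
  Unique-++-disjoint (x ∷ xs) ys (_ ∷ uq) (there a∈) a∈ys  = Unique-++-disjoint xs ys uq a∈ a∈ys

  pathGraph : List (Fin n) → Graph n
  pathGraph (x ∷ y ∷ r) = edge x y ⊕ pathGraph (y ∷ r)
  pathGraph _           = emptyGraph

  pathGraph-sound : ∀ l {a b} → pathGraph l a b ≡ true → Consec l a b
  pathGraph-sound (x ∷ y ∷ r) {a} {b} e =
    [ [ inj₁ , inj₂ ∘ inj₁ ] ∘ edge-sound x y a b , inj₂ ∘ inj₂ ∘ pathGraph-sound (y ∷ r) ] (∨-true _ _ e)

  pathGraph-complete : ∀ l {a b} → Consec l a b → pathGraph l a b ≡ true
  pathGraph-complete (x ∷ y ∷ r) (inj₁ p)        = ∨-trueˡ _ (edge-complete (inj₁ p))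
  pathGraph-complete (x ∷ y ∷ r) (inj₂ (inj₁ p)) = ∨-trueˡ _ (edge-complete (inj₂ p))
  pathGraph-complete (x ∷ y ∷ r) {a} {b} (inj₂ (inj₂ c)) = ∨-trueʳ (edge x y a b) (pathGraph-complete (y ∷ r) c)

  pathGraph-sym : ∀ l a b → pathGraph l a b ≡ pathGraph l b a
  pathGraph-sym []          a b = refl
  pathGraph-sym (x ∷ [])    a b = refl
  pathGraph-sym (x ∷ y ∷ r) a b = cong₂ _∨_ (edge-sym x y a b) (pathGraph-sym (y ∷ r) a b)

  pathGraph-∈ : ∀ l {a b} → pathGraph l a b ≡ true → a ∈ l × b ∈ l
  pathGraph-∈ l = Consec-∈ l ∘ pathGraph-sound l

  ecount-pathGraph-≤ : ∀ l → ecount (pathGraph l) ≤ length l ∸ 1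
  ecount-pathGraph-≤ []          = ≤-reflexive (ecount-loops emptyGraph λ _ _ ())
  ecount-pathGraph-≤ (x ∷ [])    = ≤-reflexive (ecount-loops emptyGraph λ _ _ ())
  ecount-pathGraph-≤ (x ∷ y ∷ r) =
    ≤-trans (ecount-⊕-≤ (edge x y) (pathGraph (y ∷ r))) (+-mono-≤ (ecount-edge-≤1 x y) (ecount-pathGraph-≤ (y ∷ r)))

  ecount-pathGraph : ∀ l → Unique l → ecount (pathGraph l) ≡ length l ∸ 1
  ecount-pathGraph []          _ = ecount-loops emptyGraph λ _ _ ()
  ecount-pathGraph (x ∷ [])    _ = ecount-loops emptyGraph λ _ _ ()
  ecount-pathGraph (x ∷ y ∷ r) (x∉ ∷ uq) =
    trans (ecount-⊕ (edge x y) (pathGraph (y ∷ r)) disjoint)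
          (cong₂ _+_ (ecount-edge (All.head x∉)) (ecount-pathGraph (y ∷ r) uq))
    where
    disjoint : ∀ a b → edge x y a b ≡ true → pathGraph (y ∷ r) a b ≡ false
    disjoint a b e = ¬-not λ e' → let (a∈ , b∈) = pathGraph-∈ (y ∷ r) e' in
      [ (λ { (refl , _) → All.lookup x∉ a∈ refl }) , (λ { (_ , refl) → All.lookup x∉ b∈ refl }) ]
        (edge-sound x y a b e)

  ecount-≤-Consec : ∀ H l → (∀ a b → H a b ≡ true → Consec l a b) → ecount H ≤ length l ∸ 1
  ecount-≤-Consec H l H⊆l = ≤-trans (ecount-mono (λ a b → pathGraph-complete l ∘ H⊆l a b)) (ecount-pathGraph-≤ l)

  PathsUpTo : ℕ → Graph n → Set
  PathsUpTo k P = ∀ C → IsComponent P C → ∃ λ m → m ≤ k × PathComp P C m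

  emptyGraph-pathsUpTo : ∀ {k} → 1 ≤ k → PathsUpTo k emptyGraph
  emptyGraph-pathsUpTo 1≤k C ((v , Cv) , comp) =
    1 , 1≤k , (v ∷ []) , refl , s≤s z≤n , (All.[] ∷ []) ,
    (λ w → mk⇔ (λ { (here refl) → Cv }) (λ Cw → here (sym (Reach-emptyGraph (to (comp v w Cv) Cw))))) ,
    (λ _ _ _ → mk⇔ (λ ()) (λ ()))

  Avoids : Graph n → List (Fin n) → Set
  Avoids Q c = ∀ a b → Q a b ≡ true → a ∉ c × b ∉ c

  module _ {c : List (Fin n)} {Q : Graph n} (Q-avoids : Avoids Q c) where

    Reach-stays-on-path : ∀ {a b} → Reach (pathGraph c ⊕ Q) a b → a ∈ c → b ∈ c
    Reach-stays-on-path here               a∈ = a∈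
    Reach-stays-on-path (step {u} {w} e r) u∈ =
      Reach-stays-on-path r ([ proj₂ ∘ pathGraph-∈ c , (λ e' → ⊥-elim (proj₁ (Q-avoids u w e') u∈)) ] (∨-true _ _ e))

    Reach-stays-off-path : ∀ {a b} → Reach (pathGraph c ⊕ Q) a b → a ∉ c → Reach Q a b × b ∉ c
    Reach-stays-off-path here               a∉ = here , a∉
    Reach-stays-off-path (step {u} {w} e r) u∉ with ∨-true (pathGraph c u w) (Q u w) e
    ... | inj₁ e' = ⊥-elim (u∉ (proj₁ (pathGraph-∈ c e')))
    ... | inj₂ e' = let (r' , b∉) = Reach-stays-off-path r (proj₂ (Q-avoids u w e')) in step e' r' , b∉

    component-on-path : ∀ {C v} → Unique c → IsComponent (pathGraph c ⊕ Q) C → C v ≡ true → v ∈ c →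
                        PathComp (pathGraph c ⊕ Q) C (length c)
    component-on-path {C} {v} uq (_ , comp) Cv v∈ = c , refl , nonempty v∈ , uq , members , adjacent
      where
      nonempty : v ∈ c → 1 ≤ length c
      nonempty (here _)  = s≤s z≤n
      nonempty (there _) = s≤s z≤n
      members : ∀ w → (w ∈ c ⇔ C w ≡ true)
      members w = mk⇔
        (λ w∈ → from (comp v w Cv) (Reach-along _ c (λ a b → ∨-trueˡ (Q a b) ∘ pathGraph-complete c) v∈ w∈))
        (λ Cw → Reach-stays-on-path (to (comp v w Cv) Cw) v∈)
      adjacent : ∀ u w → C u ≡ true → ((pathGraph c ⊕ Q) u w ≡ true ⇔ Consec c u w)
      adjacent u w Cu = mk⇔
        (λ e → [ pathGraph-sound c , (λ e' → ⊥-elim (proj₁ (Q-avoids u w e') (from (members u) Cu))) ] (∨-true _ _ e))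
        (∨-trueˡ (Q u w) ∘ pathGraph-complete c)

    component-off-path : ∀ {C v} → IsComponent (pathGraph c ⊕ Q) C → C v ≡ true → v ∉ c →
                         IsComponent Q C × (∀ u → C u ≡ true → u ∉ c)
    component-off-path {C} {v} ((_ , Cv') , comp) Cv v∉ = ((_ , Cv') , compQ) , off
      where
      off : ∀ u → C u ≡ true → u ∉ c
      off u Cu = proj₂ (Reach-stays-off-path (to (comp v u Cv) Cu) v∉)
      compQ : ∀ u w → C u ≡ true → (C w ≡ true ⇔ Reach Q u w)
      compQ u w Cu = mk⇔
        (λ Cw → proj₁ (Reach-stays-off-path (to (comp u w Cu) Cw) (off u Cu)))
        (from (comp u w Cu) ∘ Reach-mono (λ a b → ∨-trueʳ (pathGraph c a b)))

    PathComp-⊕-path : ∀ {C m} → (∀ u → C u ≡ true → u ∉ c) → PathComp Q C m → PathComp (pathGraph c ⊕ Q) C m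
    PathComp-⊕-path {C} off (vs , len , 1≤m , uq , members , adjacent) = vs , len , 1≤m , uq , members , adjacent'
      where
      adjacent' : ∀ u w → C u ≡ true → ((pathGraph c ⊕ Q) u w ≡ true ⇔ Consec vs u w)
      adjacent' u w Cu = mk⇔
        (λ e → to (adjacent u w Cu)
                  ([ (λ e' → ⊥-elim (off u Cu (proj₁ (pathGraph-∈ c e')))) , (λ e' → e') ] (∨-true _ _ e)))
        (∨-trueʳ (pathGraph c u w) ∘ from (adjacent u w Cu))

    pathGraph-⊕-pathsUpTo : ∀ {k} → Unique c → length c ≤ k → PathsUpTo k Q → PathsUpTo k (pathGraph c ⊕ Q)
    pathGraph-⊕-pathsUpTo uq c≤k Q-paths C compC@((v , Cv) , _) with any? (v ≟_) c
    ... | yes v∈ = length c , c≤k , component-on-path uq compC Cv v∈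
    ... | no  v∉ = let (compQ , off) = component-off-path compC Cv v∉
                       (m , m≤k , pathQ) = Q-paths C compQ
                   in m , m≤k , PathComp-⊕-path off pathQ

  -- The path on l cut into blocks of s consecutive vertices.  The recursion on drop s l is not
  -- structural, hence the fuel f; it suffices when s ≥ 1 and length l ≤ f.
  chunks : ℕ → ℕ → List (Fin n) → Graph n
  chunks s zero    _ = emptyGraph
  chunks s (suc f) l = pathGraph (take s l) ⊕ chunks s f (drop s l)

  module _ (s : ℕ) where

    Unique-take++drop : ∀ {l : List (Fin n)} → Unique l → Unique (take s l ++ drop s l)
    Unique-take++drop {l} = subst Unique (sym (take++drop≡id s l))

    chunks-sound : ∀ f l {a b} → chunks s f l a b ≡ true → Consec l a b
    chunks-sound (suc f) l {a} {b} e =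
      subst (λ l' → Consec l' a b) (take++drop≡id s l)
        ([ Consec-++ˡ (take s l) _ ∘ pathGraph-sound (take s l) ,
           Consec-++ʳ (take s l) _ ∘ chunks-sound f (drop s l) ] (∨-true _ _ e))

    chunks-sym : ∀ f l a b → chunks s f l a b ≡ chunks s f l b a
    chunks-sym zero    l a b = refl
    chunks-sym (suc f) l a b = cong₂ _∨_ (pathGraph-sym (take s l) a b) (chunks-sym f (drop s l) a b)

    chunks-simple : ∀ f l → Unique l → IsSimple (chunks s f l)
    chunks-simple f l uq = chunks-sym f l , λ a → ¬-not (Consec-irrefl l uq ∘ chunks-sound f l)

    chunks-avoid-first : ∀ f l → Unique l → Avoids (chunks s f (drop s l)) (take s l)
    chunks-avoid-first f l uq a b e =
      (λ a∈′ → disjoint a∈′ (proj₁ ∈drop)) , (λ b∈′ → disjoint b∈′ (proj₂ ∈drop))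
      where
      ∈drop : a ∈ drop s l × b ∈ drop s l
      ∈drop = Consec-∈ (drop s l) (chunks-sound f (drop s l) e)
      disjoint : ∀ {x} → x ∈ take s l → x ∉ drop s l
      disjoint = Unique-++-disjoint (take s l) (drop s l) (Unique-take++drop uq)

    chunks-pathsUpTo : ∀ {k} → 1 ≤ k → s ≤ k → ∀ f l → Unique l → PathsUpTo k (chunks s f l)
    chunks-pathsUpTo 1≤k s≤k zero    l uq = emptyGraph-pathsUpTo 1≤k
    chunks-pathsUpTo 1≤k s≤k (suc f) l uq =
      pathGraph-⊕-pathsUpTo (chunks-avoid-first f l uq) (take⁺ s uq)
        (≤-trans (≤-reflexive (length-take s l)) (≤-trans (m⊓n≤m s (length l)) s≤k))
        (chunks-pathsUpTo 1≤k s≤k f (drop s l) (drop⁺ s uq))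

    ecount-chunks-suc : ∀ f l → Unique l →
                        ecount (chunks s (suc f) l) ≡ ecount (pathGraph (take s l)) + ecount (chunks s f (drop s l))
    ecount-chunks-suc f l uq = ecount-⊕ _ _ λ a b e → ¬-not λ e' →
      proj₁ (chunks-avoid-first f l uq a b e') (proj₁ (pathGraph-∈ (take s l) e))

    ecount-chunks-short : ∀ f l → Unique l → length l ≤ s → ecount (chunks s (suc f) l) ≡ length l ∸ 1
    ecount-chunks-short f l uq l≤s = begin-equality
      ecount (chunks s (suc f) l)                                   ≡⟨ ecount-chunks-suc f l uq ⟩
      ecount (pathGraph (take s l)) + ecount (chunks s f (drop s l)) ≡⟨ cong₂ _+_ first rest ⟩
      length l ∸ 1 + 0                                               ≡⟨ +-identityʳ _ ⟩
      length l ∸ 1                                                   ∎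
      where
      open ≤-Reasoning
      first : ecount (pathGraph (take s l)) ≡ length l ∸ 1
      first = trans (cong (ecount ∘ pathGraph) (take-all s l l≤s)) (ecount-pathGraph l uq)
      rest : ecount (chunks s f (drop s l)) ≡ 0
      rest = ecount-loops _ λ a b e →
        ⊥-elim (subst (λ l' → Consec l' a b) (drop-all s l l≤s) (chunks-sound f (drop s l) e))

    ecount-chunks-long : ∀ f l → Unique l → s ≤ length l →
                         ecount (chunks s (suc f) l) ≡ s ∸ 1 + ecount (chunks s f (drop s l))
    ecount-chunks-long f l uq s≤l = trans (ecount-chunks-suc f l uq) (cong (_+ ecount (chunks s f (drop s l))) first)
      where
      first : ecount (pathGraph (take s l)) ≡ s ∸ 1
      first = trans (ecount-pathGraph (take s l) (take⁺ s uq))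
                    (cong (_∸ 1) (trans (length-take s l) (m≤n⇒m⊓n≡m s≤l)))

    chunks-edge-bound : ∀ f l → 0 < s → Unique l → length l ≤ f →
                        (s ∸ 1) * (length l ∸ 1) ≤ s * ecount (chunks s f l)
    chunks-edge-bound zero    []      _   _  _   = ≤-trans (≤-reflexive (*-zeroʳ (s ∸ 1))) z≤n
    chunks-edge-bound (suc f) l       0<s uq l≤f with length l ≤? s
    ... | yes l≤s = subst (λ e → (s ∸ 1) * (length l ∸ 1) ≤ s * e) (sym (ecount-chunks-short f l uq l≤s))
                          (*-monoˡ-≤ (length l ∸ 1) (m∸n≤m s 1))
    ... | no  l≰s = begin
      (s ∸ 1) * (length l ∸ 1)        ≡⟨ cong (λ L → (s ∸ 1) * (L ∸ 1)) (sym (m+[n∸m]≡n s≤l)) ⟩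
      (s ∸ 1) * (s + L′ ∸ 1)          ≡⟨ cong ((s ∸ 1) *_) (+-∸-assoc s (m<n⇒0<n∸m s<l)) ⟩
      (s ∸ 1) * (s + (L′ ∸ 1))        ≤⟨ pred*-+-≤ s (L′ ∸ 1) _ rest-bound ⟩
      s * (s ∸ 1 + ecount (chunks s f (drop s l))) ≡⟨ cong (s *_) (ecount-chunks-long f l uq s≤l) ⟨
      s * ecount (chunks s (suc f) l) ∎
      where
      open ≤-Reasoning
      s<l : s < length l
      s<l = ≰⇒> l≰s
      s≤l : s ≤ length l
      s≤l = <⇒≤ s<l
      L′ : ℕ
      L′ = length l ∸ s
      rest-bound : (s ∸ 1) * (L′ ∸ 1) ≤ s * ecount (chunks s f (drop s l))
      rest-bound = subst (λ L → (s ∸ 1) * (L ∸ 1) ≤ s * ecount (chunks s f (drop s l))) (length-drop s l)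
        (chunks-edge-bound f (drop s l) 0<s (drop⁺ s uq)
          (≤-trans (≤-reflexive (length-drop s l)) (≤-trans (∸-monoʳ-≤ (length l) 0<s) (∸-monoˡ-≤ 1 l≤f))))

chunks9-path-ratio : ∀ {n} (l : List (Fin n)) → Unique l → 4 * (length l ∸ 1) ≤ 5 * ecount (chunks 9 (length l) l)
chunks9-path-ratio l uq =
  eight-ninths⇒four-fifths (length l ∸ 1) (length l ∸ 1) (ecount (chunks 9 (length l) l))
    (*-monoˡ-≤ (length l ∸ 1) (n≤1+n 9)) (chunks-edge-bound 9 (length l) l (s≤s z≤n) uq ≤-refl)

chunks9-cycle-ratio : ∀ {n} (l : List (Fin n)) → Unique l → 5 ≤ length l →
                      4 * length l ≤ 5 * ecount (chunks 9 (length l) l)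
chunks9-cycle-ratio (x ∷ r) uq 5≤L with length (x ∷ r) ≤? 9
... | yes L≤9 = subst (λ e → 4 * length (x ∷ r) ≤ 5 * e) (sym (ecount-chunks-short 9 (length r) (x ∷ r) uq L≤9))
                      (*-≤-suc*-pred 4 5≤L)
... | no  L≰9 = eight-ninths⇒four-fifths (length (x ∷ r)) (length r) (ecount (chunks 9 (length (x ∷ r)) (x ∷ r)))
                  (*-≤-suc*-pred 9 (≰⇒> L≰9)) (chunks-edge-bound 9 (length (x ∷ r)) (x ∷ r) (s≤s z≤n) uq ≤-refl)

chunks-isKPP : ∀ {n k s} {H : Graph n} {S : VSet n} → 1 ≤ k → s ≤ k → (vs : List (Fin n)) → Unique vs →
               (∀ v → (v ∈ vs ⇔ S v ≡ true)) → (∀ a b → S a ≡ true → Consec vs a b → H a b ≡ true) →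
               ∀ f → IsKPP k H S (chunks s f vs)
chunks-isKPP {s = s} {H} {S} 1≤k s≤k vs uq members H⊇vs f =
  chunks-simple s f vs uq , inside , chunks-pathsUpTo s 1≤k s≤k f vs uq
  where
  inside : ∀ a b → chunks s f vs a b ≡ true → S a ≡ true × S b ≡ true × H a b ≡ true
  inside a b e = let consec = chunks-sound s f vs e
                     (a∈ , b∈) = Consec-∈ vs consec
                 in to (members a) a∈ , to (members b) b∈ , H⊇vs a b (to (members a) a∈) consec

FK-≤ : ∀ {n} {F : Graph n} {S : VSet n} l → (∀ a b → S a ≡ true → F a b ≡ true → Consec l a b) →
       FK F S ≤ length l ∸ 1
FK-≤ {F = F} {S} l F⊆l = ecount-≤-Consec _ l λ a b e →
  let (Fab , SaSb) = ∧-true (F a b) _ e in F⊆l a b (proj₁ (∧-true (S a) (S b) SaSb)) Fab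

module _ {n k} {F H : Graph n} {S : VSet n} (9≤k : 9 ≤ k) (F⊆H : ∀ a b → F a b ≡ true → H a b ≡ true) where

  chunks9-isKPP : ∀ vs → Unique vs → (∀ v → (v ∈ vs ⇔ S v ≡ true)) →
                  (∀ a b → S a ≡ true → Consec vs a b → F a b ≡ true) → IsKPP k H S (chunks 9 (length vs) vs)
  chunks9-isKPP vs uq members F⊇vs =
    chunks-isKPP (≤-trans (s≤s z≤n) 9≤k) 9≤k vs uq members (λ a b Sa → F⊆H a b ∘ F⊇vs a b Sa) (length vs)

  path-component-pp : ∀ {m} → PathComp F S m → ∃ λ P → IsKPP k H S P × 4 * FK F S ≤ 5 * ecount P
  path-component-pp (vs , _ , _ , uq , members , adjacent) =
    chunks 9 (length vs) vs ,
    chunks9-isKPP vs uq members (λ a b Sa → from (adjacent a b Sa)) ,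
    ≤-trans (*-monoʳ-≤ 4 (FK-≤ vs λ a b Sa → to (adjacent a b Sa))) (chunks9-path-ratio vs uq)

  cycle-component-pp : ∀ {m} → 5 ≤ m → CycleComp F S m → ∃ λ P → IsKPP k H S P × 4 * FK F S ≤ 5 * ecount P
  cycle-component-pp () ([] , refl , _)
  cycle-component-pp 5≤m (vs@(x ∷ r) , refl , _ , uq , members , adjacent) =
    chunks 9 (length vs) vs ,
    chunks9-isKPP vs uq members (λ a b Sa → from (adjacent a b Sa) ∘ Consec-++ˡ vs (x ∷ [])) ,
    ≤-trans (*-monoʳ-≤ 4 FK≤) (chunks9-cycle-ratio vs uq 5≤m)
    where
    FK≤ : FK F S ≤ length vs
    FK≤ = ≤-trans (FK-≤ (vs ++ x ∷ []) λ a b Sa → to (adjacent a b Sa))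
                  (≤-reflexive (trans (length-++ r) (+-comm (length r) 1)))

IsComponent-⊆ : ∀ {n} {H H' : Graph n} {S : VSet n} → (∀ a b → H a b ≡ true → H' a b ≡ true) →
                IsComponent H' S → SingleNode H S → IsComponent H S
IsComponent-⊆ H⊆H' (v , comp) connected = v , λ u w Su → mk⇔ (connected u w Su) (from (comp u w Su) ∘ Reach-mono H⊆H')

no-edge-inside : ∀ {n} {F W : Graph n} {S : VSet n} → (∀ a b → W a b ≡ true → ¬ Reach F a b) →
                 IsComponent (F ⊕ W) S → SingleNode F S → ¬ Saturates W S
no-edge-inside {F = F} W-between (_ , comp) single (a , b , Sa , Wab) =
  W-between a b Wab (single a b Sa (from (comp a b Sa) (step (∨-trueʳ (F a b) Wab) here)))

path-or-long-cycle : ∀ {n} {G F : Graph n} {S : VSet n} → IsMaxTFPCC G F → IsComponent F S → ¬ CycleComp F S 4 →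
                     (∃ λ m → PathComp F S m) ⊎ (∃ λ m → 5 ≤ m × CycleComp F S m)
path-or-long-cycle {F = F} {S} (((_ , _ , shapes) , triangle-free) , _) compF ¬C₄ with shapes S compF
... | inj₁ path       = inj₁ path
... | inj₂ (m , cycle) = inj₂ (m , ≤∧≢⇒< (≤∧≢⇒< 3≤m ≢3) ≢4 , cycle)
  where
  3≤m : 3 ≤ m
  3≤m = proj₁ (proj₂ (proj₂ cycle))
  ≢3 : 3 ≢ m
  ≢3 refl = triangle-free S compF cycle
  ≢4 : 4 ≢ m
  ≢4 refl = ¬C₄ cycle

lemma7 : (k : ℕ) → (k ≡ 9 ⊎ k ≡ 10) → (n : ℕ) → (G F W : Graph n) → IsSimple G → IsMaxTFPCC G F → IsW G F W → (S : VSet n) → IsComponent (F ⊕ W) S → SingleNode F S → ¬ InI4 F W S → ∃ λ P → IsKPP k (F ⊕ W) S P × 4 * FK F S ≤ 5 * ecount P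
lemma7 k k≡9⊎10 n G F W _ maxF isW S compS single notI4 =
  [ path-component-pp 9≤k F⊆F⊕W ∘ proj₂ , (λ (_ , 5≤m , cycle) → cycle-component-pp 9≤k F⊆F⊕W 5≤m cycle) ]
    (path-or-long-cycle maxF compF λ C₄ → notI4 ((compF , C₄) , unsaturated))
  where
  9≤k : 9 ≤ k
  9≤k = [ ≤-reflexive ∘ sym , (λ k≡10 → ≤-trans (n≤1+n 9) (≤-reflexive (sym k≡10))) ] k≡9⊎10
  F⊆F⊕W : ∀ a b → F a b ≡ true → (F ⊕ W) a b ≡ true
  F⊆F⊕W a b = ∨-trueˡ (W a b)
  compF : IsComponent F S
  compF = IsComponent-⊆ F⊆F⊕W compS single
  W-between : ∀ a b → W a b ≡ true → ¬ Reach F a b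
  W-between a b = proj₁ ∘ proj₂ ∘ proj₁ (proj₂ (proj₁ isW)) a b
  unsaturated : ¬ Saturates W S
  unsaturated = no-edge-inside W-between compS single
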